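{- In the setting described in the context, for every $i\in\{0,1,\dots,m\}$ the hypergraph $H_i$ is a hyperforest, every edge of $G_i$ is contained in some hyperedge of $H_i$, and for every hyperedge $F$ of $H_i$ the induced subgraph $G_i[F]$ is connected.
   Context: Let $s,t$ be positive integers. For a graph $G$ on vertex set $V$ with $|V|=s+t+1$, an edge $e$ is erasable in $G$ if there is a partition $(V^1,V^2,\{v\})$ of $V$ with $|V^1|=s$, $|V^2|=t$ such that $e$ is the only edge of $G$ between $V^1$ and $V^2$; $v$ is called the closed vertex. A graph is erasable if its edges can be removed one at a time, each removed edge being erasable in the current graph, until no edges remain. Fix a graph $G$ with the maximum number of edges among all erasable graphs on $s+t+1$ vertices, let $m=|E(G)|$, and fix an erase process: an ordering $e_1,\dots,e_m$ of $E(G)$ with graphs $G_0=G$, $G_i=G_{i-1}\setminus e_i$, such that $e_i$ is erasable in $G_{i-1}$, together with a fixed witness partition $(V_i^1,V_i^2,\{v_i\})$ for each $i$. A hyperforest is a hypergraph with no cycle, where a cycle is a sequence of $k\ge 2$ distinct hyperedges $E_1,\dots,E_k$ and distinct vertices $u_1,\dots,u_k$ with $u_1\in E_1\cap E_2,\ u_2\in E_2\cap E_3,\dots,u_k\in E_k\cap E_1$ (in particular no two hyperedges share two or more vertices). Hypergraphs $H_0,\dots,H_m$ on vertex set $V$ are defined as follows. The hyperedges of $H_0$ are the vertex sets of the connected components of $G_0$ having at least two vertices. For $i\in[m]$, $H_i$ is obtained from $H_{i-1}$ by: (1) (edge-operation) taking the unique hyperedge $F$ of $H_{i-1}$ containing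 both endpoints of $e_i$ and replacing it by the vertex sets of those connected components of $G_{i-1}[F]\setminus e_i$ that have more than one vertex (so $F$ is unchanged if $G_{i-1}[F]\setminus e_i$ is connected); then (2) (vertex-operation) for every hyperedge $F$ of the resulting hypergraph containing $v_i$, letting $F_1,\dots,F_h$ be the vertex sets of the connected components of $G_i[F\setminus\{v_i\}]$ and replacing $F$ by $F_1\cup\{v_i\},\dots,F_h\cup\{v_i\}$. -}

module Defs where

open import Data.Nat as ℕ using (ℕ; zero; suc; _+_; _≤_)
open import Data.Bool using (Bool; true; false; _∧_; if_then_else_)
open import Data.Fin as Fin using (Fin; zero; suc; toℕ; lower₁; _<?_)
open import Data.Fin.Subset using (Subset; _∈_; _∉_; _⊆_; _∪_; _-_; ⁅_⁆; ∣_∣; ⊤)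
open import Data.List using (List; []; _∷_; map; allFin; length)
open import Data.Nat.ListAction using (sum)
open import Data.Product using (Σ; Σ-syntax; _×_; _,_)
open import Data.Sum using (_⊎_)
open import Function.Definitions using (Injective)
open import Relation.Binary.PropositionalEquality using (_≡_; _≢_; sym)
open import Relation.Nullary using (¬_; yes; no; does)

Graph : ℕ → Set
Graph n = Fin n → Fin n → Bool

IsSimple : ∀ {n} → Graph n → Set
IsSimple G = (∀ x y → G x y ≡ G y x) × (∀ x → G x x ≡ false)

NoEdges : ∀ {n} → Graph n → Set
NoEdges G = ∀ x y → G x y ≡ false

numEdges : ∀ {n} → Graph n → ℕ
numEdges {n} G =
  sum (map (λ x → sum (map (λ y → if does (x <? y) ∧ G x y then 1 else 0)
                             (allFin n)))
           (allFin n))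

removeEdge : ∀ {n} → Graph n → Fin n → Fin n → Graph n
removeEdge G a b x y with does (x Fin.≟ a) ∧ does (y Fin.≟ b)
                        | does (x Fin.≟ b) ∧ does (y Fin.≟ a)
... | true  | _     = false
... | false | true  = false
... | false | false = G x y

record Witness (s t : ℕ) (G : Graph (s + t + 1)) (a b : Fin (s + t + 1)) : Set where
  field
    V¹ V² : Subset (s + t + 1)
    v : Fin (s + t + 1)
    size¹ : ∣ V¹ ∣ ≡ s
    size² : ∣ V² ∣ ≡ t
    disj : ∀ x → x ∈ V¹ → x ∉ V²
    v∉¹ : v ∉ V¹
    v∉² : v ∉ V²
    cover : ∀ x → x ∈ V¹ ⊎ x ∈ V² ⊎ x ≡ v
    crosses : (a ∈ V¹ × b ∈ V²) ⊎ (a ∈ V² × b ∈ V¹)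
    only : ∀ x y → x ∈ V¹ → y ∈ V² → G x y ≡ true →
           (x ≡ a × y ≡ b) ⊎ (x ≡ b × y ≡ a)

data EraseSeq (s t : ℕ) : Graph (s + t + 1) → Set where
  done : ∀ {G} → NoEdges G → EraseSeq s t G
  step : ∀ {G} (a b : Fin (s + t + 1)) → G a b ≡ true →
         Witness s t G a b → EraseSeq s t (removeEdge G a b) → EraseSeq s t G

Erasable : (s t : ℕ) → Graph (s + t + 1) → Set
Erasable s t G = EraseSeq s t G

IsMaxErasable : (s t : ℕ) → Graph (s + t + 1) → Set
IsMaxErasable s t G =
  IsSimple G × Erasable s t G ×
  (∀ G′ → IsSimple G′ → Erasable s t G′ → numEdges G′ ≤ numEdges G)

len : ∀ {s t G} → EraseSeq s t G → ℕ
len (done _) = 0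
len (step _ _ _ _ P) = suc (len P)

graphAt : ∀ {s t G} (P : EraseSeq s t G) → Fin (suc (len P)) → Graph (s + t + 1)
graphAt {G = G} P zero = G
graphAt (step _ _ _ _ P) (suc i) = graphAt P i

data Reach {n} (G : Graph n) (S : Subset n) (x : Fin n) : Fin n → Set where
  here  : x ∈ S → Reach G S x x
  there : ∀ {y z} → Reach G S x y → G y z ≡ true → z ∈ S → Reach G S x z

Connected : ∀ {n} → Graph n → Subset n → Set
Connected G S = ∀ x y → x ∈ S → y ∈ S → Reach G S x y

Component : ∀ {n} → Graph n → Subset n → Subset n → Set
Component G W C =
  (Σ _ λ x → x ∈ C) × C ⊆ W × Connected G C ×
  (∀ x y → x ∈ C → y ∈ W → G x y ≡ true → y ∈ C)

Hyp : ℕ → Set₁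
Hyp n = Subset n → Set

csucc : ∀ {k} → Fin (suc k) → Fin (suc k)
csucc {k} i with toℕ i ℕ.≟ k
... | yes _ = zero
... | no p  = suc (lower₁ i (λ e → p (sym e)))

Cycle : ∀ {n} → Hyp n → Set
Cycle {n} H =
  Σ ℕ λ k′ →
  Σ (Fin (suc (suc k′)) → Subset n) λ E →
  Σ (Fin (suc (suc k′)) → Fin n) λ u →
    Injective _≡_ _≡_ E × Injective _≡_ _≡_ u ×
    (∀ j → H (E j)) × (∀ j → u j ∈ E j) × (∀ j → u j ∈ E (csucc j))

Hyperforest : ∀ {n} → Hyp n → Set
Hyperforest H = ¬ Cycle H

H₀ : ∀ {n} → Graph n → Hyp n
H₀ G S = Component G ⊤ S × 2 ≤ ∣ S ∣

edgeOp : ∀ {n} → Graph n → Fin n → Fin n → Hyp n → Hyp n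
edgeOp G a b H S =
  (H S × ¬ (a ∈ S × b ∈ S)) ⊎
  (Σ (Subset _) λ F → H F × a ∈ F × b ∈ F ×
     Component (removeEdge G a b) F S × 2 ≤ ∣ S ∣)

vertexOp : ∀ {n} → Graph n → Fin n → Hyp n → Hyp n
vertexOp G′ v H S =
  (H S × v ∉ S) ⊎
  (Σ (Subset _) λ F → H F × v ∈ F ×
     Σ (Subset _) λ C → Component G′ (F - v) C × S ≡ C ∪ ⁅ v ⁆)

hypAt : ∀ {s t G} → Hyp (s + t + 1) → (P : EraseSeq s t G) →
        Fin (suc (len P)) → Hyp (s + t + 1)
hypAt H P zero = H
hypAt {G = G} H (step a b _ w P) (suc i) =
  hypAt (vertexOp (removeEdge G a b) (Witness.v w) (edgeOp G a b H)) P i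

hypergraphAt : ∀ {s t G} (P : EraseSeq s t G) → Fin (suc (len P)) → Hyp (s + t + 1)
hypergraphAt {G = G} P = hypAt (H₀ G) P

{-# OPTIONS --safe #-}

-- The three properties form an invariant of the two operations; only the
-- simplicity of G is used. H₀ is a hyperforest because its hyperedges are
-- disjoint. Both operations refine a hyperedge F into connected pieces of F,
-- any two of which share at most one fixed vertex w (none for the
-- edge-operation, v_i for the vertex-operation). A cycle of such a refinement
-- maps to a closed walk through the parent hyperedges whose transit vertices
-- are distinct, so it stays inside one hyperedge at most once (through w);
-- cutting this walk at repeated hyperedges leaves a cycle of the old
-- hyperforest. For the vertex-operation, a component C of G[F − v] contains
-- a neighbour of v because G[F] is connected, so G[C ∪ {v}] is connected.

module Submission where

open import Defs
open import Data.Nat as ℕ using (ℕ; zero; suc; _+_; _∸_; _≤_; _<_; z≤n; s≤s)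
open import Data.Nat.Properties
  using (≤-refl; ≤-trans; ≤-<-trans; <-trans; n≤1+n; m≤n⇒m<n∨m≡n; <-cmp; 1+n≢n; 0≢1+n;
         suc-injective; +-monoˡ-<; +-cancelʳ-≡; m∸n≤m; m∸n+n≡m; m+n≤o⇒m≤o∸n; anyUpTo?)
open import Data.Nat.DivMod using (_mod_; n%n≡0; m<n⇒m%n≡m)
open import Data.Nat.Induction using (<-rec)
open import Data.Bool using (true; false; _∧_)
import Data.Bool.Properties as Bool
open import Data.Fin using (Fin; zero; suc; toℕ)
open import Data.Fin.Properties using (_≟_; any?; toℕ-injective; toℕ<n; toℕ-fromℕ<; toℕ-lower₁)
open import Data.Fin.Subset using (Subset; _∈_; _∉_; _⊆_; _∪_; _-_; ⁅_⁆; ∣_∣; ⊤)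
open import Data.Fin.Subset.Properties
  using (_∈?_; ⊆-antisym; p─q⊆p; x∈p∧x≢y⇒x∈p-y; x∈p⇒∣p-x∣<∣p∣; x∈p∪q⁻; x∈p∪q⁺; x∈⁅x⁆; x∈⁅y⁆⇒x≡y; ∈⊤)
open import Data.Vec using (_∷_; there; tabulate)
open import Data.Vec.Properties using (lookup∘tabulate; lookup⇒[]=; []=⇒lookup; ≡-dec)
open import Data.Product using (Σ; ∃; _×_; _,_; proj₁; map₂; swap)
open import Data.Sum using (_⊎_; inj₁; inj₂; [_,_]′)
open import Function using (_∘_; id)
open import Relation.Nullary using (¬_; Dec; yes; no; does; proof; contradiction)
open import Relation.Nullary.Reflects using (Reflects; invert)
open import Relation.Nullary.Decidable using (map′; _×-dec_; _⊎-dec_; dec-true; dec-false)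
open import Relation.Unary using (Pred; Decidable)
open import Relation.Binary using (tri<; tri≈; tri>)
open import Relation.Binary.PropositionalEquality
  using (_≡_; _≢_; refl; sym; trans; cong; subst; module ≡-Reasoning)

private
  variable
    n : ℕ

x∉p-x : ∀ {x : Fin n} {p : Subset n} → x ∉ p - x
x∉p-x {x = zero}  {_ ∷ p} ()
x∉p-x {x = suc x} {_ ∷ p} (there x∈) = x∉p-x {x = x} {p} x∈

x≢y⇒2≤∣p∣ : ∀ {x y : Fin n} {p : Subset n} → x ≢ y → x ∈ p → y ∈ p → 2 ≤ ∣ p ∣
x≢y⇒2≤∣p∣ {x = x} {y} {p} x≢y x∈p y∈p = ≤-trans (s≤s 0<∣p-x∣) (x∈p⇒∣p-x∣<∣p∣ x∈p)
  where
  0<∣p-x∣ : 0 < ∣ p - x ∣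
  0<∣p-x∣ = ≤-<-trans z≤n (x∈p⇒∣p-x∣<∣p∣ (x∈p∧x≢y⇒x∈p-y y∈p (x≢y ∘ sym)))

module _ {ℓ} {P : Pred (Fin n) ℓ} (P? : Decidable P) where

  toSubset : Subset n
  toSubset = tabulate (does ∘ P?)

  ∈-toSubset⁺ : ∀ {x} → P x → x ∈ toSubset
  ∈-toSubset⁺ {x} Px = lookup⇒[]= x _ (trans (lookup∘tabulate (does ∘ P?) x) (dec-true (P? x) Px))

  ∈-toSubset⁻ : ∀ {x} → x ∈ toSubset → P x
  ∈-toSubset⁻ {x} x∈ =
    invert (subst (Reflects (P x)) (trans (sym (lookup∘tabulate (does ∘ P?) x)) ([]=⇒lookup x∈))
                  (proof (P? x)))

-- Reachability and components

module _ {G : Graph n} where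

  reach-source∈ : ∀ {S x y} → Reach G S x y → x ∈ S
  reach-source∈ (here x∈) = x∈
  reach-source∈ (there r _ _) = reach-source∈ r

  reach-target∈ : ∀ {S x y} → Reach G S x y → y ∈ S
  reach-target∈ (here y∈) = y∈
  reach-target∈ (there _ _ y∈) = y∈

  reach-trans : ∀ {S x y z} → Reach G S x y → Reach G S y z → Reach G S x z
  reach-trans r (here _) = r
  reach-trans r (there r′ e z∈) = there (reach-trans r r′) e z∈

  reach-cons : ∀ {S x y z} → G x y ≡ true → x ∈ S → Reach G S y z → Reach G S x z
  reach-cons e x∈ r = reach-trans (there (here x∈) e (reach-source∈ r)) r

  reach-sym : (∀ x y → G x y ≡ G y x) → ∀ {S x y} → Reach G S x y → Reach G S y x
  reach-sym sym-G (here x∈) = here x∈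
  reach-sym sym-G (there {y = y} {z} r e z∈) = reach-cons (trans (sym-G z y) e) z∈ (reach-sym sym-G r)

  reach-⊆ : ∀ {S T} → S ⊆ T → ∀ {x y} → Reach G S x y → Reach G T x y
  reach-⊆ S⊆T (here x∈) = here (S⊆T x∈)
  reach-⊆ S⊆T (there r e z∈) = there (reach-⊆ S⊆T r) e (S⊆T z∈)

  reach-uncons : ∀ {S x y} → Reach G S x y →
                 x ≡ y ⊎ ∃ λ z → G x z ≡ true × Reach G (S - x) z y
  reach-uncons (here _) = inj₁ refl
  reach-uncons {x = x} (there {z = z} r e z∈) with reach-uncons r | z ≟ x
  ... | _ | yes z≡x = inj₁ (sym z≡x)
  ... | inj₁ refl | no z≢x = inj₂ (z , e , here (x∈p∧x≢y⇒x∈p-y z∈ z≢x))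
  ... | inj₂ (z′ , e′ , r′) | no z≢x = inj₂ (z′ , e′ , there r′ e (x∈p∧x≢y⇒x∈p-y z∈ z≢x))

reach? : (G : Graph n) → ∀ S x y → Dec (Reach G S x y)
reach? G S = within ∣ S ∣ S ≤-refl
  where
  within : ∀ bound S → ∣ S ∣ ≤ bound → ∀ x y → Dec (Reach G S x y)
  within bound S ∣S∣≤ x y with x ∈? S
  ... | no x∉S = no (x∉S ∘ reach-source∈)
  ... | yes x∈S with x ≟ y
  ...   | yes refl = yes (here x∈S)
  within zero S ∣S∣≤0 x y | yes x∈S | no _ =
    contradiction (≤-trans (x∈p⇒∣p-x∣<∣p∣ x∈S) ∣S∣≤0) λ ()
  within (suc bound) S ∣S∣≤ x y | yes x∈S | no x≢y =
    map′ (λ (z , e , r) → reach-cons e x∈S (reach-⊆ (p─q⊆p S ⁅ x ⁆) r))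
         ([ (λ x≡y → contradiction x≡y x≢y) , id ]′ ∘ reach-uncons)
         (any? λ z → (G x z Bool.≟ true) ×-dec within bound (S - x) ∣S-x∣≤ z y)
    where
    ∣S-x∣≤ : ∣ S - x ∣ ≤ bound
    ∣S-x∣≤ = ℕ.≤-pred (≤-trans (x∈p⇒∣p-x∣<∣p∣ x∈S) ∣S∣≤)

component : Graph n → Subset n → Fin n → Subset n
component G W x = toSubset (reach? G W x)

module _ {G : Graph n} {W : Subset n} {x : Fin n} where

  ∈component⁺ : ∀ {y} → Reach G W x y → y ∈ component G W x
  ∈component⁺ = ∈-toSubset⁺ (reach? G W x)

  reach-within-component : ∀ {y} → Reach G W x y → Reach G (component G W x) x y
  reach-within-component (here x∈) = here (∈component⁺ (here x∈))
  reach-within-component r@(there r′ e z∈) = there (reach-within-component r′) e (∈component⁺ r)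

module _ {G : Graph n} where

  component-isComponent : (∀ x y → G x y ≡ G y x) → ∀ {W x} → x ∈ W → Component G W (component G W x)
  component-isComponent sym-G {W} {x} x∈W =
    (x , ∈component⁺ (here x∈W)) ,
    (reach-target∈ ∘ reachable) ,
    (λ y z y∈ z∈ → reach-trans (reach-sym sym-G (reach-within-component (reachable y∈)))
                               (reach-within-component (reachable z∈))) ,
    (λ y z y∈ z∈W e → ∈component⁺ (there (reachable y∈) e z∈W))
    where
    reachable : ∀ {y} → y ∈ component G W x → Reach G W x y
    reachable = ∈-toSubset⁻ (reach? G W x)

  component-closed : ∀ {W C x y} → Component G W C → x ∈ C → Reach G W x y → y ∈ C
  component-closed _ x∈C (here _) = x∈C
  component-closed C@(_ , _ , _ , closed) x∈C (there r e z∈) = closed _ _ (component-closed C x∈C r) z∈ e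

  component-unique : ∀ {W C C′ x} → Component G W C → Component G W C′ → x ∈ C → x ∈ C′ → C ≡ C′
  component-unique C@(_ , C⊆W , C-connected , _) C′@(_ , C′⊆W , C′-connected , _) x∈C x∈C′ =
    ⊆-antisym (λ y∈C → component-closed C′ x∈C′ (reach-⊆ C⊆W (C-connected _ _ x∈C y∈C)))
              (λ y∈C′ → component-closed C x∈C (reach-⊆ C′⊆W (C′-connected _ _ x∈C′ y∈C′)))

reach-subgraph : ∀ {G G′ : Graph n} {S} → (∀ {x y} → x ∈ S → y ∈ S → G x y ≡ true → G′ x y ≡ true) →
                 ∀ {x y} → Reach G S x y → Reach G′ S x y
reach-subgraph G⊆G′ (here x∈) = here x∈
reach-subgraph G⊆G′ (there r e z∈) = there (reach-subgraph G⊆G′ r) (G⊆G′ (reach-target∈ r) z∈ e) z∈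

Joins : Fin n → Fin n → Fin n → Fin n → Set
Joins a b x y = (x ≡ a × y ≡ b) ⊎ (x ≡ b × y ≡ a)

joins? : (a b x y : Fin n) → Dec (Joins a b x y)
joins? a b x y = ((x ≟ a) ×-dec (y ≟ b)) ⊎-dec ((x ≟ b) ×-dec (y ≟ a))

joins-sym : ∀ {a b x y : Fin n} → Joins a b x y → Joins a b y x
joins-sym (inj₁ (x≡a , y≡b)) = inj₂ (y≡b , x≡a)
joins-sym (inj₂ (x≡b , y≡a)) = inj₁ (y≡a , x≡b)

module _ (G : Graph n) (a b : Fin n) where

  removeEdge-joins : ∀ {x y} → Joins a b x y → removeEdge G a b x y ≡ false
  removeEdge-joins (inj₁ (refl , refl)) rewrite dec-true (a ≟ a) refl | dec-true (b ≟ b) refl = refl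
  removeEdge-joins (inj₂ (refl , refl)) rewrite dec-true (a ≟ a) refl | dec-true (b ≟ b) refl
    with does (b ≟ a) ∧ does (a ≟ b)
  ... | true  = refl
  ... | false = refl

  removeEdge-other : ∀ {x y} → ¬ Joins a b x y → removeEdge G a b x y ≡ G x y
  removeEdge-other {x} {y} ¬joins
    rewrite dec-false ((x ≟ a) ×-dec (y ≟ b)) (¬joins ∘ inj₁)
          | dec-false ((x ≟ b) ×-dec (y ≟ a)) (¬joins ∘ inj₂) = refl

  removeEdge-⊆ : ∀ {x y} → removeEdge G a b x y ≡ true → G x y ≡ true
  removeEdge-⊆ {x} {y} e with joins? a b x y
  ... | yes joins = contradiction (trans (sym e) (removeEdge-joins joins)) λ ()
  ... | no ¬joins = trans (sym (removeEdge-other ¬joins)) e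

  removeEdge-simple : IsSimple G → IsSimple (removeEdge G a b)
  removeEdge-simple (sym-G , irrefl-G) = symmetric , irreflexive
    where
    symmetric : ∀ x y → removeEdge G a b x y ≡ removeEdge G a b y x
    symmetric x y with joins? a b x y
    ... | yes joins = trans (removeEdge-joins joins) (sym (removeEdge-joins (joins-sym joins)))
    ... | no ¬joins = begin
      removeEdge G a b x y  ≡⟨ removeEdge-other ¬joins ⟩
      G x y                 ≡⟨ sym-G x y ⟩
      G y x                 ≡⟨ removeEdge-other (¬joins ∘ joins-sym) ⟨
      removeEdge G a b y x  ∎
      where open ≡-Reasoning
    irreflexive : ∀ x → removeEdge G a b x x ≡ false
    irreflexive x with joins? a b x x
    ... | yes joins = removeEdge-joins joins
    ... | no ¬joins = trans (removeEdge-other ¬joins) (irrefl-G x)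

csucc-periodic : ∀ {a} {A : Set a} {k} (f : ℕ → A) → f (suc k) ≡ f 0 →
                 ∀ (i : Fin (suc k)) → f (toℕ (csucc i)) ≡ f (suc (toℕ i))
csucc-periodic {k = k} f period i with toℕ i ℕ.≟ k
... | yes i≡k = trans (sym period) (cong (f ∘ suc) (sym i≡k))
... | no _    = cong (f ∘ suc) (toℕ-lower₁ i _)

csucc-irreflexive : ∀ {k} (i : Fin (suc (suc k))) → csucc i ≢ i
csucc-irreflexive {k} i csucc-i≡i with toℕ i ℕ.≟ suc k
... | yes i≡last = 0≢1+n (trans (cong toℕ csucc-i≡i) i≡last)
... | no _       = 1+n≢n (trans (cong suc (sym (toℕ-lower₁ i _))) (cong toℕ csucc-i≡i))

toℕ-mod : ∀ {j k} → j < suc k → toℕ (j mod suc k) ≡ j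
toℕ-mod j< = trans (toℕ-fromℕ< _) (m<n⇒m%n≡m j<)

mod-toℕ : ∀ {k} (i : Fin (suc k)) → toℕ i mod suc k ≡ i
mod-toℕ i = toℕ-injective (toℕ-mod (toℕ<n i))

mod-self : ∀ k → suc k mod suc k ≡ zero
mod-self k = toℕ-injective (trans (toℕ-fromℕ< _) (n%n≡0 (suc k)))

csucc-mod : ∀ {j k} → j < suc k → csucc (j mod suc k) ≡ suc j mod suc k
csucc-mod {j} {k} j< = begin
  csucc (j mod suc k)                    ≡⟨ mod-toℕ (csucc (j mod suc k)) ⟨
  toℕ (csucc (j mod suc k)) mod suc k    ≡⟨ csucc-periodic (_mod suc k) (mod-self k) (j mod suc k) ⟩
  suc (toℕ (j mod suc k)) mod suc k      ≡⟨ cong (λ i → suc i mod suc k) (toℕ-mod j<) ⟩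
  suc j mod suc k                        ∎
  where open ≡-Reasoning

-- Closed walks in a hypergraph

-- u j is where the walk passes from E j to E (suc j); it may stay in the
-- same hyperedge, but only by passing through w.
record ClosedWalk (H : Hyp n) (w : Fin n) (r : ℕ) (E : ℕ → Subset n) (u : ℕ → Fin n) : Set where
  field
    2≤r         : 2 ≤ r
    hyperedge   : ∀ {j} → j < r → H (E j)
    u∈E         : ∀ {j} → j < r → u j ∈ E j
    u∈E-next    : ∀ {j} → j < r → u j ∈ E (suc j)
    closed      : E r ≡ E 0
    u-injective : ∀ {i j} → i < r → j < r → u i ≡ u j → i ≡ j
    stays-at-w  : ∀ {j} → j < r → E j ≡ E (suc j) → u j ≡ w

punchIn : ℕ → ℕ → ℕ
punchIn zero    j       = suc j
punchIn (suc a) zero    = zero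
punchIn (suc a) (suc j) = suc (punchIn a j)

punchIn-≥ : ∀ {a j} → a ≤ j → punchIn a j ≡ suc j
punchIn-≥ {zero}  _         = refl
punchIn-≥ {suc a} (s≤s a≤j) = cong suc (punchIn-≥ a≤j)

punchIn-≤ : ∀ a j → punchIn a j ≤ suc j
punchIn-≤ zero    j       = ≤-refl
punchIn-≤ (suc a) zero    = z≤n
punchIn-≤ (suc a) (suc j) = s≤s (punchIn-≤ a j)

punchIn-injective : ∀ a {i j} → punchIn a i ≡ punchIn a j → i ≡ j
punchIn-injective zero    eq = suc-injective eq
punchIn-injective (suc a) {zero}  {zero}  _  = refl
punchIn-injective (suc a) {suc i} {suc j} eq = cong suc (punchIn-injective a (suc-injective eq))

module _ {ℓ} {A : Set ℓ} where

  punchIn-zero : ∀ (E : ℕ → A) a → E a ≡ E (suc a) → E (punchIn a 0) ≡ E 0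
  punchIn-zero E zero    Ea≡Ea+1 = sym Ea≡Ea+1
  punchIn-zero E (suc a) _       = refl

  punchIn-suc : ∀ (E : ℕ → A) a → E a ≡ E (suc a) → ∀ j → E (punchIn a (suc j)) ≡ E (suc (punchIn a j))
  punchIn-suc E zero          _       j       = refl
  punchIn-suc E (suc zero)    Ea≡Ea+1 zero    = sym Ea≡Ea+1
  punchIn-suc E (suc (suc a)) _       zero    = refl
  punchIn-suc E (suc a)       Ea≡Ea+1 (suc j) = punchIn-suc (E ∘ suc) a Ea≡Ea+1 j

module _ {H : Hyp n} {w : Fin n} where

  reindex : ∀ {r E u} → ClosedWalk H w r E u → (σ : ℕ → ℕ) {r′ : ℕ} → 2 ≤ r′ →
            (∀ {j} → j < r′ → σ j < r) →
            (∀ {i j} → i < r′ → j < r′ → σ i ≡ σ j → i ≡ j) →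
            (∀ {j} → j < r′ → E (σ (suc j)) ≡ E (suc (σ j))) →
            E (σ r′) ≡ E (σ 0) →
            ClosedWalk H w r′ (E ∘ σ) (u ∘ σ)
  reindex {u = u} W σ 2≤r′ σ< σ-injective σ-suc σ-closed = record
    { 2≤r         = 2≤r′
    ; hyperedge   = hyperedge ∘ σ<
    ; u∈E         = u∈E ∘ σ<
    ; u∈E-next    = λ j< → subst (u (σ _) ∈_) (sym (σ-suc j<)) (u∈E-next (σ< j<))
    ; closed      = σ-closed
    ; u-injective = λ i< j< → σ-injective i< j< ∘ u-injective (σ< i<) (σ< j<)
    ; stays-at-w  = λ j< eq → stays-at-w (σ< j<) (trans eq (σ-suc j<))
    }
    where open ClosedWalk W

  segment : ∀ {r E u a b} → ClosedWalk H w r E u → suc a < b → b < r → E a ≡ E b →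
            ClosedWalk H w (b ∸ a) (E ∘ (_+ a)) (u ∘ (_+ a))
  segment {r} {E} {a = a} {b} W 1+a<b b<r Ea≡Eb =
    reindex W (_+ a) (m+n≤o⇒m≤o∸n 2 1+a<b) (λ j< → <-trans (j+a<b j<) b<r)
      (λ _ _ → +-cancelʳ-≡ a _ _) (λ _ → refl) (trans (cong E (m∸n+n≡m a≤b)) (sym Ea≡Eb))
    where
    a≤b : a ≤ b
    a≤b = ≤-trans (n≤1+n a) (≤-trans (n≤1+n (suc a)) 1+a<b)
    j+a<b : ∀ {j} → j < b ∸ a → j + a < b
    j+a<b {j} j< = subst (j + a <_) (m∸n+n≡m a≤b) (+-monoˡ-< a j<)

  staying⇒3≤r : ∀ {r E u a} → ClosedWalk H w r E u → suc a < r → E a ≡ E (suc a) → 3 ≤ r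
  staying⇒3≤r {suc (suc (suc _))} _ _ _ = s≤s (s≤s (s≤s z≤n))
  staying⇒3≤r {2} {E} {u} {a = zero} W _ E0≡E1 =
    contradiction (u-injective (s≤s z≤n) ≤-refl u0≡u1) λ ()
    where
    open ClosedWalk W
    u0≡u1 : u 0 ≡ u 1
    u0≡u1 = trans (stays-at-w (s≤s z≤n) E0≡E1)
                  (sym (stays-at-w ≤-refl (trans (sym E0≡E1) (sym closed))))
  staying⇒3≤r {2} {a = suc _} _ (s≤s (s≤s ())) _
  staying⇒3≤r {1} _ (s≤s ()) _

  drop-stay : ∀ {r E u a} → ClosedWalk H w (suc r) E u → suc a < suc r → E a ≡ E (suc a) →
              ClosedWalk H w r (E ∘ punchIn a) (u ∘ punchIn a)
  drop-stay {r} {E} {a = a} W (s≤s 1+a≤r) Ea≡Ea+1 =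
    reindex W (punchIn a) (ℕ.≤-pred (staying⇒3≤r W (s≤s 1+a≤r) Ea≡Ea+1))
      (λ {j} j< → ≤-<-trans (punchIn-≤ a j) (s≤s j<)) (λ _ _ → punchIn-injective a)
      (λ {j} _ → punchIn-suc E a Ea≡Ea+1 j)
      (trans (cong E (punchIn-≥ (≤-trans (n≤1+n a) 1+a≤r)))
             (trans closed (sym (punchIn-zero E a Ea≡Ea+1))))
    where open ClosedWalk W

  injective⇒cycle : ∀ {r E u} → ClosedWalk H w r E u →
                    (∀ {i j} → i < r → j < r → E i ≡ E j → i ≡ j) → Cycle H
  injective⇒cycle {suc (suc k)} {E} {u} W E-injective =
    k , E ∘ toℕ , u ∘ toℕ ,
    (λ eq → toℕ-injective (E-injective (toℕ<n _) (toℕ<n _) eq)) ,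
    (λ eq → toℕ-injective (u-injective (toℕ<n _) (toℕ<n _) eq)) ,
    (λ i → hyperedge (toℕ<n i)) , (λ i → u∈E (toℕ<n i)) ,
    (λ i → subst (u (toℕ i) ∈_) (sym (csucc-periodic E closed i)) (u∈E-next (toℕ<n i)))
    where open ClosedWalk W
  injective⇒cycle {0} W = contradiction (ClosedWalk.2≤r W) λ ()
  injective⇒cycle {1} W = contradiction (ClosedWalk.2≤r W) λ { (s≤s ()) }

Repetition : (ℕ → Subset n) → ℕ → Set
Repetition E r = ∃ λ b → b < r × ∃ λ a → a < b × E a ≡ E b

repetition? : ∀ (E : ℕ → Subset n) r → Dec (Repetition E r)
repetition? E = anyUpTo? (λ b → anyUpTo? (λ a → ≡-dec Bool._≟_ (E a) (E b)) b)

¬repetition⇒injective : ∀ {E : ℕ → Subset n} {r} → ¬ Repetition E r →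
                        ∀ {i j} → i < r → j < r → E i ≡ E j → i ≡ j
¬repetition⇒injective ¬rep {i} {j} i< j< Ei≡Ej with <-cmp i j
... | tri< i<j _ _ = contradiction (j , j< , i , i<j , Ei≡Ej) ¬rep
... | tri≈ _ i≡j _ = i≡j
... | tri> _ _ j<i = contradiction (i , i< , j , j<i , sym Ei≡Ej) ¬rep

closedWalk⇒cycle : ∀ {H : Hyp n} {w r E u} → ClosedWalk H w r E u → Cycle H
closedWalk⇒cycle {n} {H} {w} {r} = <-rec Shortens shorten r
  where
  Shortens : ℕ → Set
  Shortens r = ∀ {E u} → ClosedWalk H w r E u → Cycle H

  -- A repetition E a ≡ E b either encloses the shorter closed walk
  -- E a, …, E (b ∸ 1), or, when b = suc a, is a stay that can be dropped.
  shorten : ∀ r → (∀ {r′} → r′ < r → Shortens r′) → Shortens r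
  shorten r shorter {E} W with repetition? E r
  ... | no ¬rep = injective⇒cycle W (¬repetition⇒injective ¬rep)
  ... | yes (b , b<r , a , a<b , Ea≡Eb) with m≤n⇒m<n∨m≡n a<b
  ...   | inj₁ 1+a<b = shorter (≤-<-trans (m∸n≤m b a) b<r) (segment W 1+a<b b<r Ea≡Eb)
  shorten (suc r) shorter W | yes (_ , b<r , _ , _ , Ea≡Eb) | inj₂ refl =
    shorter ≤-refl (drop-stay W b<r Ea≡Eb)

-- Refinements of hyperforests

record Refinement (H H′ : Hyp n) (w : Fin n) : Set where
  field
    parent   : ∀ {S} → H′ S → Subset n
    parent∈H : ∀ {S} (h : H′ S) → H (parent h)
    ⊆parent  : ∀ {S} (h : H′ S) → S ⊆ parent h
    siblings-meet-in-w : ∀ {S S′} (h : H′ S) (h′ : H′ S′) → parent h ≡ parent h′ → S ≢ S′ →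
                         ∀ {x} → x ∈ S → x ∈ S′ → x ≡ w

refinement-hyperforest : ∀ {H H′ : Hyp n} {w} → Refinement H H′ w → Hyperforest H → Hyperforest H′
refinement-hyperforest {n} {H} {H′} {w} R forest
  (k , E , u , E-injective , u-injective , E∈H′ , u∈E , u∈E-next) =
  forest (closedWalk⇒cycle walk)
  where
  open Refinement R
  m : ℕ
  m = suc (suc k)

  P : Fin m → Subset n
  P i = parent (E∈H′ i)

  walk : ClosedWalk H w m (P ∘ (_mod m)) (u ∘ (_mod m))
  walk = record
    { 2≤r         = s≤s (s≤s z≤n)
    ; hyperedge   = λ _ → parent∈H (E∈H′ _)
    ; u∈E         = λ _ → ⊆parent (E∈H′ _) (u∈E _)
    ; u∈E-next    = λ {j} j< →
        subst (λ i → u (j mod m) ∈ P i) (csucc-mod j<) (⊆parent (E∈H′ _) (u∈E-next _))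
    ; closed      = cong P (mod-self (suc k))
    ; u-injective = λ i< j< eq →
        trans (sym (toℕ-mod i<)) (trans (cong toℕ (u-injective eq)) (toℕ-mod j<))
    ; stays-at-w  = λ {j} j< eq →
        siblings-meet-in-w (E∈H′ _) (E∈H′ _) (trans eq (cong P (sym (csucc-mod j<))))
          (csucc-irreflexive _ ∘ sym ∘ E-injective) (u∈E _) (u∈E-next _)
    }

pairwise-disjoint⇒hyperforest : ∀ {H : Hyp n} →
  (∀ {S S′ x} → H S → H S′ → x ∈ S → x ∈ S′ → S ≡ S′) → Hyperforest H
pairwise-disjoint⇒hyperforest disjoint (k , E , u , E-injective , _ , E∈H , u∈E , u∈E-next) =
  csucc-irreflexive zero (sym (E-injective (disjoint (E∈H zero) (E∈H _) (u∈E zero) (u∈E-next zero))))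

-- The invariant along an erase process

record ForestCover (G : Graph n) (H : Hyp n) : Set where
  field
    hyperforest : Hyperforest H
    covers      : ∀ x y → G x y ≡ true → Σ (Subset n) λ F → H F × x ∈ F × y ∈ F
    connected   : ∀ F → H F → Connected G F

adjacent⇒≢ : ∀ {G : Graph n} → IsSimple G → ∀ {x y} → G x y ≡ true → x ≢ y
adjacent⇒≢ {G = G} (_ , irrefl) {x} xy refl = contradiction (trans (sym xy) (irrefl x)) λ ()

H₀-forestCover : ∀ {G : Graph n} → IsSimple G → ForestCover G (H₀ G)
H₀-forestCover {G = G} simple@(sym-G , _) = record
  { hyperforest = pairwise-disjoint⇒hyperforest {H = H₀ G} λ (C , _) (C′ , _) → component-unique C C′
  ; covers      = covers
  ; connected   = λ { F ((_ , _ , F-connected , _) , _) → F-connected }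
  }
  where
  covers : ∀ x y → G x y ≡ true → Σ (Subset _) λ F → H₀ G F × x ∈ F × y ∈ F
  covers x y xy =
    component G ⊤ x ,
    (component-isComponent sym-G {x = x} ∈⊤ , x≢y⇒2≤∣p∣ (adjacent⇒≢ simple xy) x∈ y∈) ,
    x∈ , y∈
    where
    x∈ : x ∈ component G ⊤ x
    x∈ = ∈component⁺ {G = G} (here ∈⊤)
    y∈ : y ∈ component G ⊤ x
    y∈ = ∈component⁺ {G = G} (there (here ∈⊤) xy ∈⊤)

module EdgeOperation {G : Graph n} (a b : Fin n) {H : Hyp n} where

  G′ : Graph n
  G′ = removeEdge G a b

  -- The pieces are pairwise disjoint.
  refinement : Refinement H (edgeOp G a b H) a
  refinement = record
    { parent = parent ; parent∈H = parent∈H ; ⊆parent = ⊆parent ; siblings-meet-in-w = siblings }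
    where
    parent : ∀ {S} → edgeOp G a b H S → Subset n
    parent {S} (inj₁ _) = S
    parent (inj₂ (F , _)) = F

    parent∈H : ∀ {S} (h : edgeOp G a b H S) → H (parent h)
    parent∈H (inj₁ (h , _)) = h
    parent∈H (inj₂ (_ , h , _)) = h

    ⊆parent : ∀ {S} (h : edgeOp G a b H S) → S ⊆ parent h
    ⊆parent (inj₁ _) = λ x∈ → x∈
    ⊆parent (inj₂ (_ , _ , _ , _ , (_ , S⊆F , _) , _)) = S⊆F

    siblings : ∀ {S S′} (h : edgeOp G a b H S) (h′ : edgeOp G a b H S′) → parent h ≡ parent h′ → S ≢ S′ →
               ∀ {x} → x ∈ S → x ∈ S′ → x ≡ a
    siblings (inj₁ _) (inj₁ _) refl S≢S′ _ _ = contradiction refl S≢S′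
    siblings (inj₁ (_ , ¬ab)) (inj₂ (_ , _ , a∈ , b∈ , _)) refl _ _ _ = contradiction (a∈ , b∈) ¬ab
    siblings (inj₂ (_ , _ , a∈ , b∈ , _)) (inj₁ (_ , ¬ab)) refl _ _ _ = contradiction (a∈ , b∈) ¬ab
    siblings (inj₂ (_ , _ , _ , _ , C , _)) (inj₂ (_ , _ , _ , _ , C′ , _)) refl S≢S′ x∈S x∈S′ =
      contradiction (component-unique C C′ x∈S x∈S′) S≢S′

  forestCover : IsSimple G → ForestCover G H → ForestCover G′ (edgeOp G a b H)
  forestCover simple FC = record
    { hyperforest = refinement-hyperforest refinement hyperforest
    ; covers      = covers′
    ; connected   = connected′
    }
    where
    open ForestCover FC
    simple′ : IsSimple G′
    simple′ = removeEdge-simple G a b simple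

    covers′ : ∀ x y → G′ x y ≡ true → Σ (Subset n) λ F → edgeOp G a b H F × x ∈ F × y ∈ F
    covers′ x y xy with covers x y (removeEdge-⊆ G a b xy)
    ... | F , h , x∈F , y∈F with (a ∈? F) ×-dec (b ∈? F)
    ...   | no ¬ab = F , inj₁ (h , ¬ab) , x∈F , y∈F
    ...   | yes (a∈F , b∈F) =
      component G′ F x ,
      inj₂ (F , h , a∈F , b∈F , component-isComponent (proj₁ simple′) x∈F ,
            x≢y⇒2≤∣p∣ (adjacent⇒≢ simple′ xy) x∈ y∈) ,
      x∈ , y∈
      where
      x∈ : x ∈ component G′ F x
      x∈ = ∈component⁺ (here x∈F)
      y∈ : y ∈ component G′ F x
      y∈ = ∈component⁺ (there (here x∈F) xy y∈F)

    connected′ : ∀ F → edgeOp G a b H F → Connected G′ F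
    connected′ F (inj₁ (h , ¬ab)) x y x∈ y∈ = reach-subgraph kept (connected F h x y x∈ y∈)
      where
      kept : ∀ {x y} → x ∈ F → y ∈ F → G x y ≡ true → G′ x y ≡ true
      kept x∈ y∈ xy = trans (removeEdge-other G a b ¬joins) xy
        where
        ¬joins : ¬ Joins a b _ _
        ¬joins (inj₁ (refl , refl)) = ¬ab (x∈ , y∈)
        ¬joins (inj₂ (refl , refl)) = ¬ab (y∈ , x∈)
    connected′ F (inj₂ (_ , _ , _ , _ , (_ , _ , F-connected , _) , _)) = F-connected

module _ {G : Graph n} {F C : Subset n} {v : Fin n} where

  leave-component : Component G (F - v) C → ∀ {x y} → x ∈ C → Reach G F x y →
                    y ∈ C ⊎ ∃ λ z → z ∈ C × G z v ≡ true
  leave-component _ x∈C (here _) = inj₁ x∈C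
  leave-component C@(_ , _ , _ , closed) x∈C (there {y = y} {z} r e z∈F) with leave-component C x∈C r
  ... | inj₂ exit = inj₂ exit
  ... | inj₁ y∈C with z ≟ v
  ...   | yes refl = inj₂ (y , y∈C , e)
  ...   | no z≢v   = inj₁ (closed y z y∈C (x∈p∧x≢y⇒x∈p-y z∈F z≢v) e)

  component+vertex-connected : (∀ x y → G x y ≡ G y x) → Connected G F → v ∈ F →
                               Component G (F - v) C → Connected G (C ∪ ⁅ v ⁆)
  component+vertex-connected sym-G F-connected v∈F isC@((c , c∈C) , C⊆F-v , C-connected , _) x y x∈ y∈ =
    join (split x∈) (split y∈)
    where
    C⊆C+v : C ⊆ C ∪ ⁅ v ⁆
    C⊆C+v = x∈p∪q⁺ ∘ inj₁

    v∈C+v : v ∈ C ∪ ⁅ v ⁆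
    v∈C+v = x∈p∪q⁺ (inj₂ (x∈⁅x⁆ v))

    split : ∀ {x} → x ∈ C ∪ ⁅ v ⁆ → x ∈ C ⊎ x ≡ v
    split {x} x∈ = [ inj₁ , inj₂ ∘ x∈⁅y⁆⇒x≡y v ]′ (x∈p∪q⁻ C ⁅ v ⁆ x∈)

    neighbour : ∃ λ z → z ∈ C × G z v ≡ true
    neighbour with leave-component isC c∈C (F-connected c v (p─q⊆p F ⁅ v ⁆ (C⊆F-v c∈C)) v∈F)
    ... | inj₁ v∈C = contradiction (C⊆F-v v∈C) (x∉p-x {p = F})
    ... | inj₂ exit = exit

    to-v : ∀ {x} → x ∈ C → Reach G (C ∪ ⁅ v ⁆) x v
    to-v x∈C with neighbour
    ... | z , z∈C , zv =
      reach-trans (reach-⊆ C⊆C+v (C-connected _ z x∈C z∈C)) (there (here (C⊆C+v z∈C)) zv v∈C+v)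

    join : ∀ {x y} → x ∈ C ⊎ x ≡ v → y ∈ C ⊎ y ≡ v → Reach G (C ∪ ⁅ v ⁆) x y
    join (inj₁ x∈C)  (inj₁ y∈C)  = reach-⊆ C⊆C+v (C-connected _ _ x∈C y∈C)
    join (inj₁ x∈C)  (inj₂ refl) = to-v x∈C
    join (inj₂ refl) (inj₁ y∈C)  = reach-sym sym-G (to-v y∈C)
    join (inj₂ refl) (inj₂ refl) = here v∈C+v

module VertexOperation {G : Graph n} (v : Fin n) {H : Hyp n} where

  refinement : Refinement H (vertexOp G v H) v
  refinement = record
    { parent = parent ; parent∈H = parent∈H ; ⊆parent = ⊆parent ; siblings-meet-in-w = siblings }
    where
    parent : ∀ {S} → vertexOp G v H S → Subset n
    parent {S} (inj₁ _) = S
    parent (inj₂ (F , _)) = F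

    parent∈H : ∀ {S} (h : vertexOp G v H S) → H (parent h)
    parent∈H (inj₁ (h , _)) = h
    parent∈H (inj₂ (_ , h , _)) = h

    ⊆parent : ∀ {S} (h : vertexOp G v H S) → S ⊆ parent h
    ⊆parent (inj₁ _) x∈ = x∈
    ⊆parent (inj₂ (F , _ , v∈F , C , (_ , C⊆F-v , _) , refl)) x∈ with x∈p∪q⁻ C ⁅ v ⁆ x∈
    ... | inj₁ x∈C = p─q⊆p F ⁅ v ⁆ (C⊆F-v x∈C)
    ... | inj₂ x∈v = subst (_∈ F) (sym (x∈⁅y⁆⇒x≡y v x∈v)) v∈F

    siblings : ∀ {S S′} (h : vertexOp G v H S) (h′ : vertexOp G v H S′) → parent h ≡ parent h′ → S ≢ S′ →
               ∀ {x} → x ∈ S → x ∈ S′ → x ≡ v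
    siblings (inj₁ _) (inj₁ _) refl S≢S′ _ _ = contradiction refl S≢S′
    siblings (inj₁ (_ , v∉S)) (inj₂ (_ , _ , v∈F , _)) refl _ _ _ = contradiction v∈F v∉S
    siblings (inj₂ (_ , _ , v∈F , _)) (inj₁ (_ , v∉S)) refl _ _ _ = contradiction v∈F v∉S
    siblings (inj₂ (_ , _ , _ , C , isC , refl)) (inj₂ (_ , _ , _ , C′ , isC′ , refl)) refl S≢S′ x∈S x∈S′
      with x∈p∪q⁻ C ⁅ v ⁆ x∈S | x∈p∪q⁻ C′ ⁅ v ⁆ x∈S′
    ... | inj₂ x∈v | _        = x∈⁅y⁆⇒x≡y v x∈v
    ... | inj₁ _   | inj₂ x∈v = x∈⁅y⁆⇒x≡y v x∈v
    ... | inj₁ x∈C | inj₁ x∈C′ =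
      contradiction (cong (_∪ ⁅ v ⁆) (component-unique isC isC′ x∈C x∈C′)) S≢S′

  forestCover : IsSimple G → ForestCover G H → ForestCover G (vertexOp G v H)
  forestCover simple@(sym-G , _) FC = record
    { hyperforest = refinement-hyperforest refinement hyperforest
    ; covers      = covers′
    ; connected   = connected′
    }
    where
    open ForestCover FC

    piece : ∀ {F x y} → H F → v ∈ F → x ∈ F - v → G x y ≡ true → y ∈ F →
            Σ (Subset n) λ S → vertexOp G v H S × x ∈ S × y ∈ S
    piece {F} {x} {y} h v∈F x∈F-v xy y∈F =
      component G (F - v) x ∪ ⁅ v ⁆ ,
      inj₂ (F , h , v∈F , component G (F - v) x , component-isComponent sym-G x∈F-v , refl) ,
      x∈p∪q⁺ (inj₁ (∈component⁺ (here x∈F-v))) , y∈S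
      where
      y∈S : y ∈ component G (F - v) x ∪ ⁅ v ⁆
      y∈S with y ≟ v
      ... | yes refl = x∈p∪q⁺ (inj₂ (x∈⁅x⁆ v))
      ... | no y≢v   = x∈p∪q⁺ (inj₁ (∈component⁺ (there (here x∈F-v) xy (x∈p∧x≢y⇒x∈p-y y∈F y≢v))))

    covers′ : ∀ x y → G x y ≡ true → Σ (Subset n) λ S → vertexOp G v H S × x ∈ S × y ∈ S
    covers′ x y xy with covers x y xy
    ... | F , h , x∈F , y∈F with v ∈? F
    ...   | no v∉F = F , inj₁ (h , v∉F) , x∈F , y∈F
    ...   | yes v∈F with x ≟ v
    ...     | no x≢v = piece h v∈F (x∈p∧x≢y⇒x∈p-y x∈F x≢v) xy y∈F
    ...     | yes refl = map₂ (map₂ swap)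
      (piece h v∈F (x∈p∧x≢y⇒x∈p-y y∈F (adjacent⇒≢ simple xy ∘ sym)) (trans (sym-G y v) xy) x∈F)

    connected′ : ∀ S → vertexOp G v H S → Connected G S
    connected′ S (inj₁ (h , _)) = connected S h
    connected′ _ (inj₂ (F , h , v∈F , _ , isC , refl)) =
      component+vertex-connected sym-G (connected F h) v∈F isC

forestCover-along : ∀ {s t G H} → IsSimple G → ForestCover G H → (P : EraseSeq s t G) →
                    ∀ i → ForestCover (graphAt P i) (hypAt H P i)
forestCover-along simple FC P zero = FC
forestCover-along {G = G} simple FC (step a b _ w P) (suc i) =
  forestCover-along simple′ FC′ P i
  where
  simple′ : IsSimple (removeEdge G a b)
  simple′ = removeEdge-simple G a b simple
  FC′ : ForestCover (removeEdge G a b) (vertexOp (removeEdge G a b) (Witness.v w) (edgeOp G a b _))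
  FC′ = VertexOperation.forestCover (Witness.v w) simple′ (EdgeOperation.forestCover a b simple FC)

claim2 : (s t : ℕ) → 1 ≤ s → 1 ≤ t →
    (G : Graph (s + t + 1)) → IsMaxErasable s t G →
    (P : EraseSeq s t G) → (i : Fin (suc (len P))) →
      Hyperforest (hypergraphAt P i) ×
      (∀ x y → graphAt P i x y ≡ true →
        Σ (Subset (s + t + 1)) λ F → hypergraphAt P i F × x ∈ F × y ∈ F) ×
      (∀ F → hypergraphAt P i F → Connected (graphAt P i) F)
claim2 s t _ _ G (simple , _) P i = hyperforest , covers , connected
  where open ForestCover (forestCover-along simple (H₀-forestCover simple) P i)
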